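{- Let $(P,\leq)$ be a poset, $f \in \operatorname{Aut}(P)$, and $x,y \in P$ with $x \not\leq y$. Suppose that either (i) there is $c \in P$ with $c < x$, $c$ incomparable to $y$, and $f(c) = c$; or (ii) there is $d \in P$ with $y < d$, $d$ incomparable to $x$, and $f(d) = d$. Then $\mathcal{O}_f(x) \not\leq_f^w \mathcal{O}_f(y)$.
   Context: For $f\in\operatorname{Aut}(P)$: $x\sim_f y$ iff $f^i(x)\le y\le f^j(x)$ for some $i,j\in\mathbb{Z}$, with class $\mathcal{O}_f(x)$. $\mathcal{O}_f(x) \leq_f^w \mathcal{O}_f(y)$ iff $x'\le y'$ for some $x'\sim_f x$ and some $y'\sim_f y$. -}

module Defs where

open import Level using (Level; _⊔_)
open import Data.Nat using (ℕ; zero; suc)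
open import Data.Integer using (ℤ; +_; -[1+_])
open import Data.Product using (Σ; _×_; ∃; ∃-syntax)
open import Relation.Nullary using (¬_)
open import Relation.Binary.Bundles using (Poset)

module _ {c ℓ₁ ℓ₂ : Level} (P : Poset c ℓ₁ ℓ₂) where
  open Poset P renaming (Carrier to A)

  record Aut : Set (c ⊔ ℓ₁ ⊔ ℓ₂) where
    field
      fun       : A → A
      inv       : A → A
      fun-cong  : ∀ {x y} → x ≈ y → fun x ≈ fun y
      inv-cong  : ∀ {x y} → x ≈ y → inv x ≈ inv y
      fun-inv   : ∀ x → fun (inv x) ≈ x
      inv-fun   : ∀ x → inv (fun x) ≈ x
      fun-mono  : ∀ {x y} → x ≤ y → fun x ≤ fun y
      fun-refl  : ∀ {x y} → fun x ≤ fun y → x ≤ y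

  iter : (A → A) → ℕ → A → A
  iter g zero    x = x
  iter g (suc n) x = g (iter g n x)

  pow : Aut → ℤ → A → A
  pow f (+ n)     = iter (Aut.fun f) n
  pow f -[1+ n ]  = iter (Aut.inv f) (suc n)

  _∼[_]_ : A → Aut → A → Set ℓ₂
  x ∼[ f ] y = ∃[ i ] ∃[ j ] (pow f i x ≤ y × y ≤ pow f j x)

  -- O_f(x) ≤^w_f O_f(y)  iff  x' ≤ y' for some x' ∼_f x and y' ∼_f y
  -- (stated on representatives; the relation is well defined on classes)
  WeakOrbitLe : Aut → A → A → Set (c ⊔ ℓ₂)
  WeakOrbitLe f x y = ∃[ x' ] ∃[ y' ] (x' ∼[ f ] x × y' ∼[ f ] y × x' ≤ y')

  _∥_ : A → A → Set ℓ₂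
  a ∥ b = ¬ (a ≤ b) × ¬ (b ≤ a)

  _<ₚ_ : A → A → Set (ℓ₁ ⊔ ℓ₂)
  a <ₚ b = a ≤ b × ¬ (a ≈ b)

{-# OPTIONS --safe #-}
-- The up-set and the down-set of an f-fixed point are invariant under every
-- power of f, so each is a union of ∼_f-classes. In case (i), c < x forces
-- c below every x' ∼_f x; if x' ≤ y' with y' ∼_f y, then c lies below y' and
-- hence below y, contradicting c ∥ y. Case (ii) is the order dual.
module Submission where

open import Defs
open import Level using (Level)
open import Data.Nat using (zero; suc)
open import Data.Integer using (+_; -[1+_])
open import Data.Product using (_×_; ∃-syntax; _,_)
open import Data.Sum using (_⊎_; inj₁; inj₂)
open import Relation.Nullary using (¬_)
open import Relation.Binary.Bundles using (Poset)
open import Relation.Binary.Definitions using (_Respects_)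

module _ {c ℓ₁ ℓ₂ : Level} (P : Poset c ℓ₁ ℓ₂) where
  open Poset P renaming (Carrier to A)

  iter-preserves : (g : A → A) (Q : A → Set ℓ₂) →
    (∀ {a} → Q a → Q (g a)) → ∀ n {a} → Q a → Q (iter P g n a)
  iter-preserves g Q step zero    q = q
  iter-preserves g Q step (suc n) q = step (iter-preserves g Q step n q)

  iter-reflects : (g : A → A) (Q : A → Set ℓ₂) →
    (∀ {a} → Q (g a) → Q a) → ∀ n {a} → Q (iter P g n a) → Q a
  iter-reflects g Q step zero    q = q
  iter-reflects g Q step (suc n) q = iter-reflects g Q step n (step q)

  module Invariant (f : Aut P) (Q : A → Set ℓ₂) (Q-resp-≈ : Q Respects _≈_)
                   (fun-preserves : ∀ {a} → Q a → Q (Aut.fun f a))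
                   (fun-reflects : ∀ {a} → Q (Aut.fun f a) → Q a) where
    open Aut f

    inv-preserves : ∀ {a} → Q a → Q (inv a)
    inv-preserves {a} q = fun-reflects (Q-resp-≈ (Eq.sym (fun-inv a)) q)

    inv-reflects : ∀ {a} → Q (inv a) → Q a
    inv-reflects {a} q = Q-resp-≈ (fun-inv a) (fun-preserves q)

    pow-preserves : ∀ i {a} → Q a → Q (pow P f i a)
    pow-preserves (+ n)    = iter-preserves fun Q fun-preserves n
    pow-preserves -[1+ n ] = iter-preserves inv Q inv-preserves (suc n)

    pow-reflects : ∀ i {a} → Q (pow P f i a) → Q a
    pow-reflects (+ n)    = iter-reflects fun Q fun-reflects n
    pow-reflects -[1+ n ] = iter-reflects inv Q inv-reflects (suc n)

  module FixedPoint (f : Aut P) {p : A} (fp≈p : Aut.fun f p ≈ p) where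
    open Aut f

    private
      module Above = Invariant f (p ≤_) ≤-respʳ-≈
        (λ p≤a → trans (reflexive (Eq.sym fp≈p)) (fun-mono p≤a))
        (λ p≤fa → fun-refl (trans (reflexive fp≈p) p≤fa))
      module Below = Invariant f (_≤ p) ≤-respˡ-≈
        (λ a≤p → trans (fun-mono a≤p) (reflexive fp≈p))
        (λ fa≤p → fun-refl (trans fa≤p (reflexive (Eq.sym fp≈p))))

    ≥-fixed-∼ : ∀ {a b} → _∼[_]_ P a f b → p ≤ a → p ≤ b
    ≥-fixed-∼ (i , _ , fⁱa≤b , _) p≤a = trans (Above.pow-preserves i p≤a) fⁱa≤b

    ≥-fixed-∼⁻ : ∀ {a b} → _∼[_]_ P a f b → p ≤ b → p ≤ a
    ≥-fixed-∼⁻ (_ , j , _ , b≤fʲa) p≤b = Above.pow-reflects j (trans p≤b b≤fʲa)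

    ≤-fixed-∼ : ∀ {a b} → _∼[_]_ P a f b → a ≤ p → b ≤ p
    ≤-fixed-∼ (_ , j , _ , b≤fʲa) a≤p = trans b≤fʲa (Below.pow-preserves j a≤p)

    ≤-fixed-∼⁻ : ∀ {a b} → _∼[_]_ P a f b → b ≤ p → a ≤ p
    ≤-fixed-∼⁻ (i , _ , fⁱa≤b , _) b≤p = Below.pow-reflects i (trans fⁱa≤b b≤p)

mainTheorem17 : ∀ {c ℓ₁ ℓ₂ : Level} (P : Poset c ℓ₁ ℓ₂) (f : Aut P) →
    let open Poset P renaming (Carrier to A) in
    (x y : A) →
    ¬ (x ≤ y) →
    ((∃[ c₀ ] ((_<ₚ_ P c₀ x) × (_∥_ P c₀ y) × (Aut.fun f c₀ ≈ c₀)))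
      ⊎ (∃[ d ] ((_<ₚ_ P y d) × (_∥_ P d x) × (Aut.fun f d ≈ d)))) →
    ¬ WeakOrbitLe P f x y
mainTheorem17 P f x y _ (inj₁ (c₀ , (c₀≤x , _) , (c₀≰y , _) , fc₀≈c₀))
                        (x' , y' , x'∼x , y'∼y , x'≤y') =
  c₀≰y (≥-fixed-∼ y'∼y (trans (≥-fixed-∼⁻ x'∼x c₀≤x) x'≤y'))
  where open Poset P
        open FixedPoint P f fc₀≈c₀
mainTheorem17 P f x y _ (inj₂ (d , (y≤d , _) , (_ , x≰d) , fd≈d))
                        (x' , y' , x'∼x , y'∼y , x'≤y') =
  x≰d (≤-fixed-∼ x'∼x (trans x'≤y' (≤-fixed-∼⁻ y'∼y y≤d)))
  where open Poset P
        open FixedPoint P f fd≈d
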